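{- Let $G$ be the directed graph and $\mathcal{P}$ the path family described in the context. Each path in $\mathcal{P}$ is a shortest path between its endpoints in $G$.
   Context: Let $n$ be divisible by $3$ and $m=n/3$. The directed graph $G=(V,E,w)$ has vertices $v_i^1,v_i^2,v_i^3$ for $i=1,\dots,m$, forming cycles $C_i$. If $i$ is odd ($C_i$ "forward"), $C_i$ consists of edges $(v_i^1,v_i^2),(v_i^2,v_i^3),(v_i^3,v_i^1)$; if $i$ is even ($C_i$ "backward"), $C_i$ consists of edges $(v_i^1,v_i^3),(v_i^3,v_i^2),(v_i^2,v_i^1)$. In addition, for every $i<m$ and $k\in\{1,2,3\}$ there is a cross-cycle edge $(v_i^k,v_{i+1}^k)$. Every edge of $C_i$ has weight $1/3^i$; every cross-cycle edge has weight $0$. The family $\mathcal{P}$: for each $i<m$ and each edge $(v_i^k,v_i^{k'})$ of $C_i$, $\mathcal{P}$ contains the path from $v_i^k$ to $v_{i+1}^{k'}$ that takes the cross-cycle edge $(v_i^k,v_{i+1}^k)$ and then follows the cycle $C_{i+1}$ from $v_{i+1}^k$ to $v_{i+1}^{k'}$ (two edges of $C_{i+1}$). -}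

module Defs where

open import Data.Nat using (ℕ; zero; suc; _^_)
open import Data.Nat.Properties using (m^n≢0)
open import Data.Fin using (Fin; zero; suc; toℕ)
open import Data.Bool using (Bool; true; false)
open import Data.Product using (_×_; _,_)
open import Data.Integer using (+_)
open import Data.Rational using (ℚ; _/_; _+_; _≤_; 0ℚ)
open import Relation.Binary.PropositionalEquality using (_≡_)

-- Vertex v_i^k of G (for a given m) is the pair (i , k) with
--   i : Fin m  encoding the cycle index  toℕ i + 1  ∈ {1,…,m}
--   k : Fin 3  encoding the superscript  toℕ k + 1  ∈ {1,2,3}
Vertex : ℕ → Set
Vertex m = Fin m × Fin 3

idx : ∀ {m} → Fin m → ℕ
idx i = suc (toℕ i)

odd : ℕ → Bool
odd zero = false
odd (suc zero) = true
odd (suc (suc n)) = odd n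

fwd : Fin 3 → Fin 3
fwd zero = suc zero
fwd (suc zero) = suc (suc zero)
fwd (suc (suc zero)) = zero

bwd : Fin 3 → Fin 3
bwd zero = suc (suc zero)
bwd (suc (suc zero)) = suc zero
bwd (suc zero) = zero

next : ℕ → Fin 3 → Fin 3
next i k with odd i
... | true  = fwd k
... | false = bwd k

data Edge {m : ℕ} : Vertex m → Vertex m → Set where
  cyc   : (i : Fin m) (k : Fin 3) → Edge (i , k) (i , next (idx i) k)
  cross : (i j : Fin m) → toℕ j ≡ suc (toℕ i) → (k : Fin 3) → Edge (i , k) (j , k)

inv3^ : ℕ → ℚ
inv3^ i = (+ 1) / (3 ^ i)
  where instance _ = m^n≢0 3 i

weight : ∀ {m} {u v : Vertex m} → Edge u v → ℚ
weight (cyc i k) = inv3^ (idx i)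
weight (cross i j _ k) = 0ℚ

data Walk {m : ℕ} : Vertex m → Vertex m → Set where
  []  : ∀ {v} → Walk v v
  _∷_ : ∀ {u w v} → Edge u w → Walk w v → Walk u v

infixr 5 _∷_

length : ∀ {m} {u v : Vertex m} → Walk u v → ℚ
length [] = 0ℚ
length (e ∷ p) = weight e + length p

IsShortest : ∀ {m} {u v : Vertex m} → Walk u v → Set
IsShortest {m} {u} {v} p = (q : Walk u v) → length p ≤ length q

-- The member of 𝒫 associated with the edge (v_i^k , v_i^{k'}) of C_i (i < m,
-- witnessed by j = i+1): take (v_i^k , v_{i+1}^k), then two edges of C_{i+1}.
pathP : ∀ {m} (i j : Fin m) (e : toℕ j ≡ suc (toℕ i)) (k : Fin 3) →
        Walk (i , k) (j , next (idx j) (next (idx j) k))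
pathP i j e k = cross i j e k ∷ cyc j k ∷ cyc j (next (idx j) k) ∷ []

{-# OPTIONS --safe #-}
module Submission where

-- A walk cannot be shorter than the rise of any feasible potential along it (one that
-- no edge lets increase by more than its weight).  Put w = 1/3^(i+1), the weight of an
-- edge of C_{i+1}, and let φ be w times: 2 on C_1, …, C_{i-1}; the distance from k along
-- the orientation of C_{i+1} on both C_i and C_{i+1}; 0 on later cycles.  Cross edges
-- never raise φ, and an edge of C_i weighs 3w ≥ 2w, so φ is feasible; φ rises by 2w,
-- the length of the path in 𝒫, from v_i^k to its endpoint.

open import Defs
open import Data.Nat using (ℕ; suc)
open import Data.Fin using (Fin; toℕ)
open import Relation.Binary.PropositionalEquality using (_≡_)

open import Data.Nat as ℕ using (zero; _^_; z≤n; s≤s; NonZero)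
import Data.Nat.Properties as ℕ
open import Data.Integer as ℤ using (+_; +≤+)
import Data.Integer.Properties as ℤ
open import Data.Rational.Unnormalised as ℚᵘ using (mkℚᵘ; *≤*)
import Data.Rational.Unnormalised.Properties as ℚᵘ
open import Data.Rational using (ℚ; 0ℚ; _+_; _≤_; _/_; toℚᵘ)
open import Data.Rational.Properties
  using (≤-refl; ≤-reflexive; module ≤-Reasoning; +-identityˡ; +-identityʳ; +-assoc; +-mono-≤;
         +-monoˡ-≤; +-monoʳ-≤; +-0-monoid; nonNegative⁻¹; normalize-nonNeg; toℚᵘ-cancel-≤;
         toℚᵘ-homo-+; toℚᵘ-fromℚᵘ)
open import Algebra.Properties.Monoid.Mult +-0-monoid using (_×_; ×-homo-+)
open import Data.Fin.Properties using (_≟_; all?)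
open import Data.Product using (_,_)
open import Data.Sum using (_⊎_; inj₁; inj₂)
open import Data.Bool using (true; false)
open import Relation.Nullary using (yes; no; contradiction)
open import Relation.Nullary.Decidable using (from-yes)
open import Relation.Binary.PropositionalEquality using (refl; sym; trans; cong; subst; module ≡-Reasoning)

Feasible : ∀ {m} → (Vertex m → ℚ) → Set
Feasible φ = ∀ {u v} (e : Edge u v) → φ v ≤ φ u + weight e

feasible⇒≤-length : ∀ {m} {φ : Vertex m → ℚ} → Feasible φ →
                    ∀ {u v} (p : Walk u v) → φ v ≤ φ u + length p
feasible⇒≤-length {φ = φ} feasible {u} [] = ≤-reflexive (sym (+-identityʳ (φ u)))
feasible⇒≤-length {φ = φ} feasible {u} {v} (_∷_ {w = w} e p) = begin
  φ v                         ≤⟨ feasible⇒≤-length feasible p ⟩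
  φ w + length p              ≤⟨ +-monoˡ-≤ (length p) (feasible e) ⟩
  (φ u + weight e) + length p ≡⟨ +-assoc (φ u) (weight e) (length p) ⟩
  φ u + (weight e + length p) ∎
  where open ≤-Reasoning

×-nonNeg : ∀ n {w} → 0ℚ ≤ w → 0ℚ ≤ n × w
×-nonNeg zero    w≥0 = ≤-refl
×-nonNeg (suc n) w≥0 = +-mono-≤ w≥0 (×-nonNeg n w≥0)

×-monoˡ-≤ : ∀ {w} → 0ℚ ≤ w → ∀ {m n} → m ℕ.≤ n → m × w ≤ n × w
×-monoˡ-≤ w≥0 {n = n} z≤n = ×-nonNeg n w≥0
×-monoˡ-≤ {w} w≥0 (s≤s m≤n) = +-monoʳ-≤ w (×-monoˡ-≤ w≥0 m≤n)

×-step-≤ : ∀ {w} → 0ℚ ≤ w → ∀ {p q c ω} → q ℕ.≤ p ℕ.+ c → c × w ≤ ω →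
           q × w ≤ p × w + ω
×-step-≤ {w} w≥0 {p} {q} {c} {ω} q≤p+c cw≤ω = begin
  q × w           ≤⟨ ×-monoˡ-≤ w≥0 q≤p+c ⟩
  (p ℕ.+ c) × w   ≡⟨ ×-homo-+ w p c ⟩
  p × w + c × w   ≤⟨ +-monoʳ-≤ (p × w) cw≤ω ⟩
  p × w + ω       ∎
  where open ≤-Reasoning

double-*-≤-square : ∀ {a b} → a ℕ.+ a ℕ.≤ b → (b ℕ.+ b) ℕ.* a ℕ.≤ b ℕ.* b
double-*-≤-square {a} {b} 2a≤b = begin
  (b ℕ.+ b) ℕ.* a     ≡⟨ ℕ.*-distribʳ-+ a b b ⟩
  b ℕ.* a ℕ.+ b ℕ.* a ≡⟨ ℕ.*-distribˡ-+ b a a ⟨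
  b ℕ.* (a ℕ.+ a)     ≤⟨ ℕ.*-monoʳ-≤ b 2a≤b ⟩
  b ℕ.* b             ∎
  where open ℕ.≤-Reasoning

recip-double-≤ᵘ : ∀ a b → suc a ℕ.+ suc a ℕ.≤ suc b →
                  mkℚᵘ (+ 1) b ℚᵘ.+ mkℚᵘ (+ 1) b ℚᵘ.≤ mkℚᵘ (+ 1) a
recip-double-≤ᵘ a b 2A≤B = *≤* (begin
  (+ 1 ℤ.* + B ℤ.+ + 1 ℤ.* + B) ℤ.* + A ≡⟨ cong (λ z → (z ℤ.+ z) ℤ.* + A) (ℤ.*-identityˡ (+ B)) ⟩
  + ((B ℕ.+ B) ℕ.* A)                   ≤⟨ +≤+ (double-*-≤-square 2A≤B) ⟩
  + (B ℕ.* B)                           ≡⟨ ℤ.*-identityˡ (+ (B ℕ.* B)) ⟨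
  + 1 ℤ.* (+ B ℤ.* + B)                 ∎)
  where
  open ℤ.≤-Reasoning
  A = suc a
  B = suc b

recip-double-≤ : ∀ a b .{{_ : NonZero a}} .{{_ : NonZero b}} → a ℕ.+ a ℕ.≤ b →
                 + 1 / b + + 1 / b ≤ + 1 / a
recip-double-≤ (suc a) (suc b) 2a≤b = toℚᵘ-cancel-≤ (begin
  toℚᵘ (x + x)              ≃⟨ toℚᵘ-homo-+ x x ⟩
  toℚᵘ x ℚᵘ.+ toℚᵘ x        ≃⟨ ℚᵘ.+-cong (toℚᵘ-fromℚᵘ 1/B) (toℚᵘ-fromℚᵘ 1/B) ⟩
  mkℚᵘ (+ 1) b ℚᵘ.+ mkℚᵘ (+ 1) b ≤⟨ recip-double-≤ᵘ a b 2a≤b ⟩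
  mkℚᵘ (+ 1) a              ≃⟨ toℚᵘ-fromℚᵘ (mkℚᵘ (+ 1) a) ⟨
  toℚᵘ (+ 1 / suc a)        ∎)
  where
  open ℚᵘ.≤-Reasoning
  x = + 1 / suc b
  1/B = mkℚᵘ (+ 1) b

inv3^-nonNeg : ∀ n → 0ℚ ≤ inv3^ n
inv3^-nonNeg n = nonNegative⁻¹ (inv3^ n) {{normalize-nonNeg 1 (3 ^ n) {{ℕ.m^n≢0 3 n}}}}

inv3^-double-≤ : ∀ n → inv3^ (suc n) + inv3^ (suc n) ≤ inv3^ n
inv3^-double-≤ n = recip-double-≤ (3 ^ n) (3 ^ suc n) {{ℕ.m^n≢0 3 n}} {{ℕ.m^n≢0 3 (suc n)}}
  (ℕ.+-monoʳ-≤ (3 ^ n) (ℕ.m≤m+n (3 ^ n) (3 ^ n ℕ.+ 0)))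

cycleDistance : (Fin 3 → Fin 3) → Fin 3 → Fin 3 → ℕ
cycleDistance N k x with x ≟ k | x ≟ N k
... | yes _ | _     = 0
... | no _  | yes _ = 1
... | no _  | no _  = 2

cycleDistance≤2 : ∀ N k x → cycleDistance N k x ℕ.≤ 2
cycleDistance≤2 N k x with x ≟ k | x ≟ N k
... | yes _ | _     = z≤n
... | no _  | yes _ = s≤s z≤n
... | no _  | no _  = ℕ.≤-refl

cycleDistance-self : ∀ N k → cycleDistance N k k ≡ 0
cycleDistance-self N k with k ≟ k
... | yes _  = refl
... | no k≢k = contradiction refl k≢k

cycleDistance-next : ∀ n k x →
  cycleDistance (next n) k (next n x) ℕ.≤ cycleDistance (next n) k x ℕ.+ 1
cycleDistance-next n with odd n
... | true  = from-yes (all? λ k → all? λ x →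
                cycleDistance fwd k (fwd x) ℕ.≤? cycleDistance fwd k x ℕ.+ 1)
... | false = from-yes (all? λ k → all? λ x →
                cycleDistance bwd k (bwd x) ℕ.≤? cycleDistance bwd k x ℕ.+ 1)

cycleDistance-next² : ∀ n k → cycleDistance (next n) k (next n (next n k)) ≡ 2
cycleDistance-next² n with odd n
... | true  = from-yes (all? λ k → cycleDistance fwd k (fwd (fwd k)) ℕ.≟ 2)
... | false = from-yes (all? λ k → cycleDistance bwd k (bwd (bwd k)) ℕ.≟ 2)

-- With a = toℕ i and c = toℕ of a cycle index (both 0-based), cost a c is a lower bound,
-- in units of w = 1/3^(a+2), on the weight of an edge of that cycle, and potential a c x
-- is φ/w at the vertex x of that cycle.
cost : ℕ → ℕ → ℕ
cost zero    zero          = 2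
cost zero    (suc zero)    = 1
cost zero    (suc (suc c)) = 0
cost (suc a) zero          = 0
cost (suc a) (suc c)       = cost a c

cost-diag : ∀ a → cost a a ≡ 2
cost-diag zero    = refl
cost-diag (suc a) = cost-diag a

cost-subdiag : ∀ a → cost a (suc a) ≡ 1
cost-subdiag zero    = refl
cost-subdiag (suc a) = cost-subdiag a

cost-cases : ∀ a c → c ≡ a ⊎ c ≡ suc a ⊎ cost a c ≡ 0
cost-cases zero    zero          = inj₁ refl
cost-cases zero    (suc zero)    = inj₂ (inj₁ refl)
cost-cases zero    (suc (suc c)) = inj₂ (inj₂ refl)
cost-cases (suc a) zero          = inj₂ (inj₂ refl)
cost-cases (suc a) (suc c) with cost-cases a c
... | inj₁ c≡a             = inj₁ (cong suc c≡a)
... | inj₂ (inj₁ c≡1+a)    = inj₂ (inj₁ (cong suc c≡1+a))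
... | inj₂ (inj₂ cost≡0)   = inj₂ (inj₂ cost≡0)

cost-×-≤ : ∀ a c → cost a c × inv3^ (suc (suc a)) ≤ inv3^ (suc c)
cost-×-≤ a c with cost-cases a c
... | inj₁ refl rewrite cost-diag a = begin
  2 × w ≡⟨ cong (λ v → w + v) (+-identityʳ w) ⟩
  w + w ≤⟨ inv3^-double-≤ (suc a) ⟩
  inv3^ (suc a) ∎
  where
  open ≤-Reasoning
  w = inv3^ (suc (suc a))
... | inj₂ (inj₁ refl) rewrite cost-subdiag a = ≤-reflexive (+-identityʳ _)
... | inj₂ (inj₂ cost≡0) rewrite cost≡0 = inv3^-nonNeg (suc c)

module _ (d : Fin 3 → ℕ) where

  potential : ℕ → ℕ → Fin 3 → ℕ
  potential zero    zero             = d
  potential zero    (suc zero)       = d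
  potential zero    (suc (suc c))    = λ _ → 0
  potential (suc a) zero             = λ _ → 2
  potential (suc a) (suc c)          = potential a c

  potential-diag : ∀ a x → potential a a x ≡ d x
  potential-diag zero    x = refl
  potential-diag (suc a) x = potential-diag a x

  potential-subdiag : ∀ a x → potential a (suc a) x ≡ d x
  potential-subdiag zero    x = refl
  potential-subdiag (suc a) x = potential-subdiag a x

  module _ (d≤2 : ∀ x → d x ℕ.≤ 2) where

    potential≤2 : ∀ a c x → potential a c x ℕ.≤ 2
    potential≤2 zero    zero          x = d≤2 x
    potential≤2 zero    (suc zero)    x = d≤2 x
    potential≤2 zero    (suc (suc c)) x = z≤n
    potential≤2 (suc a) zero          x = ℕ.≤-refl
    potential≤2 (suc a) (suc c)       x = potential≤2 a c x

    potential-suc≤ : ∀ a c x → potential a (suc c) x ℕ.≤ potential a c x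
    potential-suc≤ zero    zero       x = ℕ.≤-refl
    potential-suc≤ zero    (suc c)    x = z≤n
    potential-suc≤ (suc a) zero       x = potential≤2 a zero x
    potential-suc≤ (suc a) (suc c)    x = potential-suc≤ a c x

    potential-cycle : ∀ a c x y → (c ≡ suc a → d y ℕ.≤ d x ℕ.+ 1) →
                      potential a c y ℕ.≤ potential a c x ℕ.+ cost a c
    potential-cycle zero    zero          x y _ = ℕ.≤-trans (d≤2 y) (ℕ.m≤n+m 2 (d x))
    potential-cycle zero    (suc zero)    x y step = step refl
    potential-cycle zero    (suc (suc c)) x y _ = z≤n
    potential-cycle (suc a) zero          x y _ = ℕ.≤-refl
    potential-cycle (suc a) (suc c)       x y step =
      potential-cycle a c x y (λ c≡1+a → step (cong suc c≡1+a))

module Certificate {m} (i j : Fin m) (e : toℕ j ≡ suc (toℕ i)) (k : Fin 3) where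

  N : Fin 3 → Fin 3
  N = next (idx j)

  w : ℚ
  w = inv3^ (idx j)

  d : Fin 3 → ℕ
  d = cycleDistance N k

  φ : Vertex m → ℚ
  φ (c , x) = potential d (toℕ i) (toℕ c) x × w

  φ-feasible : Feasible φ
  φ-feasible (cross c c′ c′≡1+c x) = ×-step-≤ (inv3^-nonNeg (idx j)) {c = 0} (begin
    potential d (toℕ i) (toℕ c′) x      ≡⟨ cong (λ t → potential d (toℕ i) t x) c′≡1+c ⟩
    potential d (toℕ i) (suc (toℕ c)) x ≤⟨ potential-suc≤ d (cycleDistance≤2 N k) (toℕ i) (toℕ c) x ⟩
    potential d (toℕ i) (toℕ c) x       ≡⟨ ℕ.+-identityʳ _ ⟨
    potential d (toℕ i) (toℕ c) x ℕ.+ 0 ∎) ≤-refl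
    where open ℕ.≤-Reasoning
  φ-feasible (cyc c x) = ×-step-≤ (inv3^-nonNeg (idx j)) {c = cost (toℕ i) (toℕ c)}
    (potential-cycle d (cycleDistance≤2 N k) (toℕ i) (toℕ c) x (next (idx c) x) step)
    (subst (λ t → cost (toℕ i) (toℕ c) × inv3^ (suc t) ≤ weight (cyc c x)) (sym e)
      (cost-×-≤ (toℕ i) (toℕ c)))
    where
    step : toℕ c ≡ suc (toℕ i) → d (next (idx c) x) ℕ.≤ d x ℕ.+ 1
    step c≡j = subst (λ n → d (next n x) ℕ.≤ d x ℕ.+ 1) (cong suc (trans e (sym c≡j)))
      (cycleDistance-next (idx j) k x)

  φ-source : φ (i , k) ≡ 0ℚ
  φ-source = cong (_× w) (trans (potential-diag d (toℕ i) k) (cycleDistance-self N k))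

  φ-target : φ (j , N (N k)) ≡ 2 × w
  φ-target = cong (_× w) (begin
    potential d (toℕ i) (toℕ j) (N (N k))        ≡⟨ cong (λ t → potential d (toℕ i) t (N (N k))) e ⟩
    potential d (toℕ i) (suc (toℕ i)) (N (N k))  ≡⟨ potential-subdiag d (toℕ i) (N (N k)) ⟩
    d (N (N k))                                  ≡⟨ cycleDistance-next² (idx j) k ⟩
    2                                            ∎)
    where open ≡-Reasoning

lemma2p1 : (m : ℕ) (i j : Fin m) (e : toℕ j ≡ suc (toℕ i)) (k : Fin 3) →
           IsShortest (pathP i j e k)
lemma2p1 m i j e k q = begin
  length (pathP i j e k) ≡⟨ +-identityˡ (2 × w) ⟩
  2 × w                  ≡⟨ φ-target ⟨
  φ (j , N (N k))        ≤⟨ feasible⇒≤-length φ-feasible q ⟩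
  φ (i , k) + length q   ≡⟨ cong (_+ length q) φ-source ⟩
  0ℚ + length q          ≡⟨ +-identityˡ (length q) ⟩
  length q               ∎
  where
  open Certificate i j e k
  open ≤-Reasoning
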